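{- Every arrow of $\mathrm{Sp}(\mathbf{Rel}_f^c)$ is equal to an expression built from the ten arrows $\Delta, \bot, \nabla, \top, \Lambda, \downarrow, \mathsf{V}, \uparrow, \mathsf{I}, \mathsf{X}$ (defined below) using only composition $;$ and tensor $\otimes$.
   Context: A set with contention ($c$-set) is a pair $(X, \frown_X)$ with $\frown_X \subseteq X\times X$ reflexive and symmetric; it is discrete if $\frown_X$ is the diagonal. A $c$-set morphism $h : X \to Y$ is a function with $h(x) \frown_Y h(x') \Rightarrow x \frown_X x'$. $\mathcal{P}_c X$ is the set of independent subsets $U \subseteq X$ (those with $u \frown_X u' \Rightarrow u = u'$), a $c$-set with $U \frown V$ iff some $u\in U, v\in V$ have $u\frown_X v$. $\mathbf{Rel}_f^c$ is the category of finite $c$-sets whose arrows $X \nrightarrow Y$ are $c$-set morphisms $X \to \mathcal{P}_c Y$, with identity $x \mapsto \{x\}$ and composition $k\circ h = k^\# \circ h$, $k^\#(U) = \bigcup_{u\in U} k(u)$; it has pullbacks. $\mathrm{Sp}(\mathbf{Rel}_f^c)$ has objects the natural numbers $k$ (identified with the discrete $c$-set $\{0,\dots,k-1\}$) and arrows $k \to l$ the isomorphism classes of spans $k \xleftarrow{a} X \xrightarrow{b} l$ in $\mathbf{Rel}_f^c$ with $X$ a finite $c$-set; composition $;$ (diagrammatic order) is by pullback in $\mathbf{Rel}_f^c$. The tensor $\otimes$ sends spans $k_1 \leftarrow X_1 \rightarrow l_1$ and $k_2 \leftarrow X_2 \rightarrow l_2$ to $k_1 + k_2 \leftarrow X_1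 + X_2 \rightarrow l_1 + l_2$, where $X_1 + X_2$ is the disjoint union with $(x,i) \frown (y,j)$ iff $i = j$ and $x \frown_{X_i} y$, the legs act componentwise, and $k_1 + k_2$ is identified with the ordinal $k_1+k_2$. Writing a span as (carrier; left leg; right leg), with $\mathbf{2}$ denoting the $c$-set $\{0,1\}$ with all pairs in contention: $\Delta : 1 \to 2$ is (discrete $\{0\}$; $0 \mapsto \{0\}$; $0 \mapsto \{0,1\}$); $\bot : 1 \to 0$ is (discrete $\{0\}$; $0\mapsto\{0\}$; $0 \mapsto \varnothing$); $\nabla : 2 \to 1$ is (discrete $\{0\}$; $0 \mapsto \{0,1\}$; $0 \mapsto \{0\}$); $\top : 0 \to 1$ is (discrete $\{0\}$; $0\mapsto\varnothing$; $0 \mapsto \{0\}$); $\Lambda : 1 \to 2$ is ($\mathbf{2}$; $i \mapsto \{0\}$; $i \mapsto \{i\}$); $\downarrow : 1 \to 0$ is (empty carrier; empty; empty); $\mathsf{V} : 2 \to 1$ is ($\mathbf{2}$; $i \mapsto \{i\}$; $i \mapsto \{0\}$); $\uparrow : 0 \to 1$ is (empty carrier; empty; empty); $\mathsf{I} : 1 \to 1$ is (discrete $\{0\}$; $0\mapsto\{0\}$; $0\mapsto\{0\}$); $\mathsf{X} : 2 \to 2$ is (discrete $\{0,1\}$; $i \mapsto \{i\}$; $i \mapsto \{1-i\}$). -}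

module Defs where

open import Data.Nat using (ℕ; zero; suc; _+_)
open import Data.Fin using (Fin; zero; suc; splitAt; opposite; _≟_)
open import Data.Bool using (Bool; true; false; _∧_; _∨_)
open import Data.Sum using (_⊎_; inj₁; inj₂)
open import Data.Product using (Σ; _×_; _,_; ∃; ∃-syntax)
open import Relation.Nullary.Decidable using (⌊_⌋)
open import Relation.Binary.PropositionalEquality using (_≡_)

-- Finite sets with contention, represented on carriers Fin n.
-- The contention relation is a Bool-valued relation (finite, so decidable).

Sub : ℕ → Set
Sub n = Fin n → Bool

record CSet : Set where
  constructor cset
  field
    size : ℕ
    con  : Fin size → Fin size → Bool
open CSet public

IsCSet : CSet → Set
IsCSet X = (∀ x → con X x x ≡ true) × (∀ x y → con X x y ≡ con X y x)

disc : ℕ → CSet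
disc k = cset k (λ x y → ⌊ x ≟ y ⌋)

two : CSet
two = cset 2 (λ _ _ → true)

Independent : (Y : CSet) → Sub (size Y) → Set
Independent Y U = ∀ u v → U u ≡ true → U v ≡ true → con Y u v ≡ true → u ≡ v

PCon : (Y : CSet) → Sub (size Y) → Sub (size Y) → Set
PCon Y U V = Σ (Fin (size Y)) λ u → Σ (Fin (size Y)) λ v →
  (U u ≡ true) × (V v ≡ true) × (con Y u v ≡ true)

-- Arrows of Rel_f^c: raw data (a function X → subsets of Y) and the
-- predicate saying it is a c-set morphism X → 𝒫_c Y.

RArr : CSet → CSet → Set
RArr X Y = Fin (size X) → Sub (size Y)

IsArr : (X Y : CSet) → RArr X Y → Set
IsArr X Y h = (∀ x → Independent Y (h x))
            × (∀ x x' → PCon Y (h x) (h x') → con X x x' ≡ true)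

anyF : (n : ℕ) → (Fin n → Bool) → Bool
anyF zero    f = false
anyF (suc n) f = f zero ∨ anyF n (λ i → f (suc i))

idR : (X : CSet) → RArr X X
idR X x y = ⌊ x ≟ y ⌋

-- k^# (U) = ⋃_{u ∈ U} k(u)
-- (stated on the underlying sizes, since it does not use contention)
sharp : {b c : ℕ} → (Fin b → Sub c) → Sub b → Sub c
sharp {b} k U z = anyF b (λ u → U u ∧ k u z)

_∘R_ : {a b c : ℕ} → (Fin b → Sub c) → (Fin a → Sub b) → (Fin a → Sub c)
(k ∘R h) x = sharp k (h x)

infix 4 _≈R_
_≈R_ : {a b : ℕ} → (Fin a → Sub b) → (Fin a → Sub b) → Set
h ≈R h' = ∀ x y → h x y ≡ h' x y

IsPullback : {A B C : CSet} (f : RArr A C) (g : RArr B C)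
             (P : CSet) (p₁ : RArr P A) (p₂ : RArr P B) → Set
IsPullback {A} {B} {C} f g P p₁ p₂ =
  (f ∘R p₁ ≈R g ∘R p₂) ×
  ((Z : CSet) → IsCSet Z → (q₁ : RArr Z A) (q₂ : RArr Z B) →
     IsArr Z A q₁ → IsArr Z B q₂ → f ∘R q₁ ≈R g ∘R q₂ →
     Σ (RArr Z P) λ u → IsArr Z P u × (p₁ ∘R u ≈R q₁) × (p₂ ∘R u ≈R q₂) ×
       ((u' : RArr Z P) → IsArr Z P u' → p₁ ∘R u' ≈R q₁ → p₂ ∘R u' ≈R q₂ →
          u' ≈R u))

record Span (k l : ℕ) : Set where
  constructor span
  field
    carrier : CSet
    left    : RArr carrier (disc k)
    right   : RArr carrier (disc l)
open Span public

WfSpan : {k l : ℕ} → Span k l → Set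
WfSpan {k} {l} S = IsCSet (carrier S)
                 × IsArr (carrier S) (disc k) (left S)
                 × IsArr (carrier S) (disc l) (right S)

-- isomorphism of spans (so arrows of Sp(Rel_f^c) are ≅-classes)
_≅S_ : {k l : ℕ} → Span k l → Span k l → Set
_≅S_ {k} {l} S S' =
  Σ (RArr (carrier S) (carrier S')) λ φ →
  Σ (RArr (carrier S') (carrier S)) λ ψ →
    IsArr (carrier S) (carrier S') φ × IsArr (carrier S') (carrier S) ψ ×
    (ψ ∘R φ ≈R idR (carrier S)) × (φ ∘R ψ ≈R idR (carrier S')) ×
    (left S' ∘R φ ≈R left S) × (right S' ∘R φ ≈R right S)

-- Tensor (disjoint sum; k₁ + k₂ as the ordinal, via splitAt)

sumRel : {a b c d : ℕ} → (Fin a → Fin b → Bool) → (Fin c → Fin d → Bool) →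
         Fin a ⊎ Fin c → Fin b ⊎ Fin d → Bool
sumRel r s (inj₁ x) (inj₁ y) = r x y
sumRel r s (inj₂ x) (inj₂ y) = s x y
sumRel r s (inj₁ x) (inj₂ y) = false
sumRel r s (inj₂ x) (inj₁ y) = false

_⊕_ : {a b c d : ℕ} → (Fin a → Fin b → Bool) → (Fin c → Fin d → Bool) →
      Fin (a + c) → Fin (b + d) → Bool
_⊕_ {a} {b} r s z w = sumRel r s (splitAt a z) (splitAt b w)

_+C_ : CSet → CSet → CSet
X +C Y = cset (size X + size Y) (con X ⊕ con Y)

_⊗S_ : {k₁ l₁ k₂ l₂ : ℕ} → Span k₁ l₁ → Span k₂ l₂ → Span (k₁ + k₂) (l₁ + l₂)
S₁ ⊗S S₂ = span (carrier S₁ +C carrier S₂) (left S₁ ⊕ left S₂) (right S₁ ⊕ right S₂)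

allR : {m n : ℕ} → Fin m → Fin n → Bool
allR _ _ = true

noneR0 : {m : ℕ} → Fin m → Fin 0 → Bool
noneR0 _ ()

empty : CSet
empty = cset 0 (λ ())

ΔS : Span 1 2
ΔS = span (disc 1) allR allR

⊥S : Span 1 0
⊥S = span (disc 1) allR noneR0

∇S : Span 2 1
∇S = span (disc 1) allR allR

⊤S : Span 0 1
⊤S = span (disc 1) noneR0 allR

ΛS : Span 1 2
ΛS = span two allR (λ i j → ⌊ i ≟ j ⌋)

↓S : Span 1 0
↓S = span empty (λ ()) (λ ())

VS : Span 2 1
VS = span two (λ i j → ⌊ i ≟ j ⌋) allR

↑S : Span 0 1
↑S = span empty (λ ()) (λ ())

IS : Span 1 1
IS = span (disc 1) allR allR

XS : Span 2 2
XS = span (disc 2) (λ i j → ⌊ i ≟ j ⌋) (λ i j → ⌊ opposite i ≟ j ⌋)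

data Expr : ℕ → ℕ → Set where
  Δ   : Expr 1 2
  ⊥e  : Expr 1 0
  ∇   : Expr 2 1
  ⊤e  : Expr 0 1
  Λ   : Expr 1 2
  ↓e  : Expr 1 0
  V   : Expr 2 1
  ↑e  : Expr 0 1
  I   : Expr 1 1
  X   : Expr 2 2
  _⨾_ : {k l m : ℕ} → Expr k l → Expr l m → Expr k m
  _⊗_ : {k₁ l₁ k₂ l₂ : ℕ} → Expr k₁ l₁ → Expr k₂ l₂ → Expr (k₁ + k₂) (l₁ + l₂)

-- Denotes e S : the span S is a representative of the arrow denoted by e,
-- with composition computed by (any) pullback in Rel_f^c.
data Denotes : {k l : ℕ} → Expr k l → Span k l → Set where
  dΔ : Denotes Δ ΔS
  d⊥ : Denotes ⊥e ⊥S
  d∇ : Denotes ∇ ∇S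
  d⊤ : Denotes ⊤e ⊤S
  dΛ : Denotes Λ ΛS
  d↓ : Denotes ↓e ↓S
  dV : Denotes V VS
  d↑ : Denotes ↑e ↑S
  dI : Denotes I IS
  dX : Denotes X XS
  d⊗ : {k₁ l₁ k₂ l₂ : ℕ} {e₁ : Expr k₁ l₁} {e₂ : Expr k₂ l₂}
       {S₁ : Span k₁ l₁} {S₂ : Span k₂ l₂} →
       Denotes e₁ S₁ → Denotes e₂ S₂ → Denotes (e₁ ⊗ e₂) (S₁ ⊗S S₂)
  d⨾ : {k l m : ℕ} {e₁ : Expr k l} {e₂ : Expr l m}
       {S₁ : Span k l} {S₂ : Span l m} →
       Denotes e₁ S₁ → Denotes e₂ S₂ →
       (P : CSet) (p₁ : RArr P (carrier S₁)) (p₂ : RArr P (carrier S₂)) →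
       IsCSet P → IsArr P (carrier S₁) p₁ → IsArr P (carrier S₂) p₂ →
       IsPullback {carrier S₁} {carrier S₂} {disc l} (right S₁) (left S₂) P p₁ p₂ →
       Denotes (e₁ ⨾ e₂) (span P (left S₁ ∘R p₁) (right S₂ ∘R p₂))

-- Spans are compared up to strict isomorphism (a contention-preserving bijection of
-- carriers commuting with both legs), which gives ≅S through graphs.  The central notion
-- is the minimal span of c : n ⇸ m: carrier n, left leg the identity, right leg c, and
-- the least contention making c an arrow (equal points, or points with meeting images).
--
-- 1. Pullbacks against a leg y ↦ {y} are computed explicitly (IdentityPullback); since
--    pullbacks transport along strict isomorphisms, composing a denoted span T with a
--    denoted minimal span only enlarges the contention of T (denotes-⨾M).
-- 2. Minimal spans denoted by expressions ("expressible") are closed under ⊗ and under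
--    suitable composites.  The generators, identities and discards are expressible; the
--    gadget adjoin l c : 1 + l ⇸ l is built by induction on l from X, I, Δ, V and ⊥, and
--    then every minimal span is expressible by induction on its source.
-- 3. The mirror of an expression (Δ↔∇, ⊥↔⊤, Λ↔V, ↓↔↑) denotes the transposed span.
-- 4. A well-formed span S = (k ← X → l) with legs a, b decomposes as
--      transpose (Minimal a) ; Minimal b⁺ ; Minimal cut,
--    where b⁺ adds to b one output per contending pair of X, so that the contention
--    forced by b⁺ is exactly that of X, and cut discards these outputs again.
module Submission where

open import Defs
open import Data.Nat using (ℕ; zero; suc; _+_; _*_)
open import Data.Fin
  using (Fin; zero; suc; splitAt; join; lift; opposite; _≟_; _↑ˡ_; _↑ʳ_; remQuot; combine)
open import Data.Fin.Properties
  using (splitAt-join; join-splitAt; splitAt-↑ˡ; splitAt-↑ʳ; splitAt⁻¹-↑ˡ; splitAt⁻¹-↑ʳ;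
         ↑ˡ-injective; ↑ʳ-injective; suc-injective; remQuot-combine)
open import Data.Bool using (Bool; true; false; _∧_; _∨_)
open import Data.Bool.Properties using (∨-identityʳ)
open import Data.Empty using (⊥-elim)
open import Data.Sum using (_⊎_; inj₁; inj₂; [_,_]) renaming (map to ⊎-map)
open import Data.Product using (Σ; _×_; _,_; proj₁; proj₂)
open import Function using (_∘_; id)
open import Relation.Nullary.Decidable using (⌊_⌋; yes; no)
open import Relation.Binary.PropositionalEquality hiding ([_])

Holds : Bool → Set
Holds b = b ≡ true

refute : ∀ {A : Set} {b} → b ≡ false → Holds b → A
refute refl ()

∨-introˡ : ∀ {a b} → Holds a → Holds (a ∨ b)
∨-introˡ {true} _ = refl

∨-introʳ : ∀ {a b} → Holds b → Holds (a ∨ b)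
∨-introʳ {true}  _ = refl
∨-introʳ {false} p = p

∨-elim : ∀ {a b} → Holds (a ∨ b) → Holds a ⊎ Holds b
∨-elim {true}  _ = inj₁ refl
∨-elim {false} p = inj₂ p

∧-intro : ∀ {a b} → Holds a → Holds b → Holds (a ∧ b)
∧-intro refl q = q

∧-elimˡ : ∀ {a b} → Holds (a ∧ b) → Holds a
∧-elimˡ {true} _ = refl

∧-elimʳ : ∀ {a b} → Holds (a ∧ b) → Holds b
∧-elimʳ {true} p = p

bool-ext : ∀ {a b} → (Holds a → Holds b) → (Holds b → Holds a) → a ≡ b
bool-ext {true}          to   _    = sym (to refl)
bool-ext {false} {true}  _    from = from refl
bool-ext {false} {false} _    _    = refl

≟-sound : ∀ {n} {x y : Fin n} → Holds ⌊ x ≟ y ⌋ → x ≡ y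
≟-sound {x = x} {y} p with x ≟ y
... | yes x≡y = x≡y
... | no  _   = refute refl p

≟-complete : ∀ {n} {x y : Fin n} → x ≡ y → Holds ⌊ x ≟ y ⌋
≟-complete {x = x} refl with x ≟ x
... | yes _   = refl
... | no  x≢x = ⊥-elim (x≢x refl)

≟-refl : ∀ {n} (x : Fin n) → Holds ⌊ x ≟ x ⌋
≟-refl x = ≟-complete refl

≟-injective : ∀ {a b} (f : Fin a → Fin b) → (∀ {x y} → f x ≡ f y → x ≡ y) →
  ∀ x y → ⌊ f x ≟ f y ⌋ ≡ ⌊ x ≟ y ⌋
≟-injective f inj x y =
  bool-ext (λ p → ≟-complete (inj (≟-sound p))) (λ p → ≟-complete (cong f (≟-sound p)))

ι : ∀ n → Fin n → Sub n
ι n = idR (disc n)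

anyF-intro : ∀ n (f : Fin n → Bool) i → Holds (f i) → Holds (anyF n f)
anyF-intro (suc n) f zero    p = ∨-introˡ p
anyF-intro (suc n) f (suc i) p = ∨-introʳ {f zero} (anyF-intro n (f ∘ suc) i p)

anyF-elim : ∀ n (f : Fin n → Bool) → Holds (anyF n f) → Σ (Fin n) λ i → Holds (f i)
anyF-elim (suc n) f p with ∨-elim {f zero} p
... | inj₁ q = zero , q
... | inj₂ q with anyF-elim n (f ∘ suc) q
...   | i , r = suc i , r

anyF-cong : ∀ n {f g : Fin n → Bool} → (∀ i → f i ≡ g i) → anyF n f ≡ anyF n g
anyF-cong zero    e = refl
anyF-cong (suc n) e = cong₂ _∨_ (e zero) (anyF-cong n (e ∘ suc))

anyF-false : ∀ n → anyF n (λ _ → false) ≡ false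
anyF-false zero    = refl
anyF-false (suc n) = anyF-false n

anyF-reindex : ∀ {m n} (to : Fin m → Fin n) (from : Fin n → Fin m) →
  (∀ y → to (from y) ≡ y) → (h : Fin n → Bool) → anyF m (h ∘ to) ≡ anyF n h
anyF-reindex {m} {n} to from to-from h = bool-ext
  (λ p → let (x , q) = anyF-elim m _ p in anyF-intro n h (to x) q)
  (λ p → let (y , q) = anyF-elim n h p in
     anyF-intro m (h ∘ to) (from y) (subst (Holds ∘ h) (sym (to-from y)) q))

sharp-intro : ∀ {b c} (k : Fin b → Sub c) (U : Sub b) {u z} →
  Holds (U u) → Holds (k u z) → Holds (sharp k U z)
sharp-intro {b} k U {u} p q = anyF-intro b (λ w → U w ∧ k w _) u (∧-intro p q)

sharp-elim : ∀ {b c} (k : Fin b → Sub c) (U : Sub b) {z} →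
  Holds (sharp k U z) → Σ (Fin b) λ u → Holds (U u) × Holds (k u z)
sharp-elim {b} k U p = let (u , q) = anyF-elim b _ p in u , ∧-elimˡ q , ∧-elimʳ {U u} q

sharp-ι : ∀ n (U : Sub n) a → sharp (ι n) U a ≡ U a
sharp-ι n U a = bool-ext
  (λ p → let (u , Uu , u≡a) = sharp-elim (ι n) U p in subst (Holds ∘ U) (≟-sound u≡a) Uu)
  (λ p → sharp-intro (ι n) U p (≟-refl a))

sharp-singleton : ∀ {n m} (h : Fin n → Sub m) a z → sharp h (ι n a) z ≡ h a z
sharp-singleton {n} h a z = bool-ext
  (λ p → let (u , a≡u , hu) = sharp-elim h (ι n a) p in
     subst (λ w → Holds (h w z)) (sym (≟-sound a≡u)) hu)
  (λ p → sharp-intro h (ι n a) (≟-refl a) p)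

sharp-point : ∀ {n l m} (b : Fin n → Sub l) (c : Fin l → Sub m) x s →
  b x ≗ ι l s → ∀ z → (c ∘R b) x z ≡ c s z
sharp-point {l = l} b c x s e z =
  trans (anyF-cong l (λ y → cong (_∧ c y z) (e y))) (sharp-singleton c s z)

record CIso (C D : CSet) : Set where
  field
    to      : Fin (size C) → Fin (size D)
    from    : Fin (size D) → Fin (size C)
    to-from : ∀ y → to (from y) ≡ y
    from-to : ∀ x → from (to x) ≡ x
    to-con  : ∀ x x' → con D (to x) (to x') ≡ con C x x'
open CIso public

CIso-refl : ∀ C → CIso C C
CIso-refl C = record
  { to = id ; from = id ; to-from = λ _ → refl ; from-to = λ _ → refl ; to-con = λ _ _ → refl }

CIso-sym : ∀ {C D} → CIso C D → CIso D C
CIso-sym {D = D} i = record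
  { to = from i ; from = to i ; to-from = from-to i ; from-to = to-from i
  ; to-con = λ y y' → trans (sym (to-con i (from i y) (from i y')))
                            (cong₂ (con D) (to-from i y) (to-from i y')) }

CIso-trans : ∀ {C D E} → CIso C D → CIso D E → CIso C E
CIso-trans i j = record
  { to = to j ∘ to i ; from = from i ∘ from j
  ; to-from = λ z → trans (cong (to j) (to-from i (from j z))) (to-from j z)
  ; from-to = λ x → trans (cong (from i) (from-to j (to i x))) (from-to i x)
  ; to-con  = λ x x' → trans (to-con j (to i x) (to i x')) (to-con i x x') }

record SpanIso {k l} (S T : Span k l) : Set where
  constructor spanIso
  field
    carrier-iso : CIso (carrier S) (carrier T)
    left-iso    : (λ x → left T (to carrier-iso x)) ≈R left S
    right-iso   : (λ x → right T (to carrier-iso x)) ≈R right S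

SpanIso-trans : ∀ {k l} {S T W : Span k l} → SpanIso S T → SpanIso T W → SpanIso S W
SpanIso-trans (spanIso i l₁ r₁) (spanIso j l₂ r₂) =
  spanIso (CIso-trans i j)
    (λ x y → trans (l₂ (to i x) y) (l₁ x y)) (λ x y → trans (r₂ (to i x) y) (r₁ x y))

SpanIso-pointwise : ∀ {k l} (C : CSet) {c' : Fin (size C) → Fin (size C) → Bool}
  {a a' : RArr C (disc k)} {b b' : RArr C (disc l)} →
  con C ≈R c' → a ≈R a' → b ≈R b' → SpanIso (span C a b) (span (cset (size C) c') a' b')
SpanIso-pointwise C ec ea eb =
  spanIso (record { to = id ; from = id ; to-from = λ _ → refl ; from-to = λ _ → refl
                   ; to-con = λ x x' → sym (ec x x') })
          (λ x j → sym (ea x j)) (λ x j → sym (eb x j))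

graph-isArr : ∀ {C D} (i : CIso C D) → IsArr C D (λ x → ι (size D) (to i x))
graph-isArr {D = D} i =
  (λ x u v p q _ → trans (sym (≟-sound p)) (≟-sound q)) ,
  (λ x x' (u , v , p , q , r) →
     trans (sym (to-con i x x'))
           (subst₂ (λ a b → Holds (con D a b)) (sym (≟-sound p)) (sym (≟-sound q)) r))

SpanIso→≅ : ∀ {k l} {S T : Span k l} → SpanIso S T → S ≅S T
SpanIso→≅ {S = S} {T} (spanIso i el er) =
  graph , graph⁻¹ , graph-isArr i , graph-isArr (CIso-sym i) ,
  (λ x x' → trans (sharp-singleton graph⁻¹ (to i x) x') (cong (λ w → ⌊ w ≟ x' ⌋) (from-to i x))) ,
  (λ y y' → trans (sharp-singleton graph (from i y) y') (cong (λ w → ⌊ w ≟ y' ⌋) (to-from i y))) ,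
  (λ x j → trans (sharp-singleton (left T) (to i x) j) (el x j)) ,
  (λ x j → trans (sharp-singleton (right T) (to i x) j) (er x j))
  where
  graph = λ x → ι (size (carrier T)) (to i x)
  graph⁻¹ = λ y → ι (size (carrier S)) (from i y)

_+ᶠ_ : ∀ {a b c d} → (Fin a → Fin c) → (Fin b → Fin d) → Fin (a + b) → Fin (c + d)
_+ᶠ_ {a} {_} {c} {d} f g = join c d ∘ ⊎-map f g ∘ splitAt a

splitAt-+ᶠ : ∀ {a b c d} (f : Fin a → Fin c) (g : Fin b → Fin d) x →
  splitAt c ((f +ᶠ g) x) ≡ ⊎-map f g (splitAt a x)
splitAt-+ᶠ {c = c} {d} f g x = splitAt-join c d _

+ᶠ-inverse : ∀ {a b c d} (f₁ : Fin a → Fin c) (f₂ : Fin b → Fin d)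
  (g₁ : Fin c → Fin a) (g₂ : Fin d → Fin b) →
  (∀ i → g₁ (f₁ i) ≡ i) → (∀ j → g₂ (f₂ j) ≡ j) → ∀ x → (g₁ +ᶠ g₂) ((f₁ +ᶠ f₂) x) ≡ x
+ᶠ-inverse {a} {b} {c} {d} f₁ f₂ g₁ g₂ e₁ e₂ x = begin
  join a b (⊎-map g₁ g₂ (splitAt c (join c d (⊎-map f₁ f₂ (splitAt a x)))))
    ≡⟨ cong (join a b ∘ ⊎-map g₁ g₂) (splitAt-join c d (⊎-map f₁ f₂ (splitAt a x))) ⟩
  join a b (⊎-map g₁ g₂ (⊎-map f₁ f₂ (splitAt a x)))
    ≡⟨ cong (join a b) (map-inverse (splitAt a x)) ⟩
  join a b (splitAt a x)
    ≡⟨ join-splitAt a b x ⟩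
  x ∎
  where
  open ≡-Reasoning
  map-inverse : ∀ u → ⊎-map g₁ g₂ (⊎-map f₁ f₂ u) ≡ u
  map-inverse (inj₁ i) = cong inj₁ (e₁ i)
  map-inverse (inj₂ j) = cong inj₂ (e₂ j)

module _ {a b c d : ℕ} where

  ⊕-reindexˡ : ∀ {a' c'} (r : Fin a → Fin b → Bool) (s : Fin c → Fin d → Bool)
    (f : Fin a' → Fin a) (g : Fin c' → Fin c) x y →
    (r ⊕ s) ((f +ᶠ g) x) y ≡ ((r ∘ f) ⊕ (s ∘ g)) x y
  ⊕-reindexˡ {a'} r s f g x y
    rewrite splitAt-+ᶠ f g x with splitAt a' x | splitAt b y
  ... | inj₁ _ | inj₁ _ = refl
  ... | inj₁ _ | inj₂ _ = refl
  ... | inj₂ _ | inj₁ _ = refl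
  ... | inj₂ _ | inj₂ _ = refl

  ⊕-reindexʳ : ∀ {b' d'} (r : Fin a → Fin b → Bool) (s : Fin c → Fin d → Bool)
    (f : Fin b' → Fin b) (g : Fin d' → Fin d) x y →
    (r ⊕ s) x ((f +ᶠ g) y) ≡ ((λ i → r i ∘ f) ⊕ (λ i → s i ∘ g)) x y
  ⊕-reindexʳ {b'} r s f g x y
    rewrite splitAt-+ᶠ f g y with splitAt a x | splitAt b' y
  ... | inj₁ _ | inj₁ _ = refl
  ... | inj₁ _ | inj₂ _ = refl
  ... | inj₂ _ | inj₁ _ = refl
  ... | inj₂ _ | inj₂ _ = refl

  ⊕-cong : {r r' : Fin a → Fin b → Bool} {s s' : Fin c → Fin d → Bool} →
    r ≈R r' → s ≈R s' → (r ⊕ s) ≈R (r' ⊕ s')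
  ⊕-cong er es x y with splitAt a x | splitAt b y
  ... | inj₁ i | inj₁ j = er i j
  ... | inj₁ _ | inj₂ _ = refl
  ... | inj₂ _ | inj₁ _ = refl
  ... | inj₂ i | inj₂ j = es i j

CIso-+ : ∀ {C₁ D₁ C₂ D₂} → CIso C₁ D₁ → CIso C₂ D₂ → CIso (C₁ +C C₂) (D₁ +C D₂)
CIso-+ {D₁ = D₁} {D₂ = D₂} i₁ i₂ = record
  { to = to i₁ +ᶠ to i₂ ; from = from i₁ +ᶠ from i₂
  ; to-from = +ᶠ-inverse (from i₁) (from i₂) (to i₁) (to i₂) (to-from i₁) (to-from i₂)
  ; from-to = +ᶠ-inverse (to i₁) (to i₂) (from i₁) (from i₂) (from-to i₁) (from-to i₂)
  ; to-con  = λ x x' →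
      trans (⊕-reindexˡ (con D₁) (con D₂) (to i₁) (to i₂) x ((to i₁ +ᶠ to i₂) x'))
     (trans (⊕-reindexʳ (con D₁ ∘ to i₁) (con D₂ ∘ to i₂) (to i₁) (to i₂) x x')
            (⊕-cong (to-con i₁) (to-con i₂) x x')) }

SpanIso-⊗ : ∀ {k₁ l₁ k₂ l₂} {S₁ T₁ : Span k₁ l₁} {S₂ T₂ : Span k₂ l₂} →
  SpanIso S₁ T₁ → SpanIso S₂ T₂ → SpanIso (S₁ ⊗S S₂) (T₁ ⊗S T₂)
SpanIso-⊗ {T₁ = T₁} {T₂ = T₂} (spanIso i₁ l₁ r₁) (spanIso i₂ l₂ r₂) =
  spanIso (CIso-+ i₁ i₂)
    (λ x j → trans (⊕-reindexˡ (left T₁) (left T₂) (to i₁) (to i₂) x j) (⊕-cong l₁ l₂ x j))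
    (λ x j → trans (⊕-reindexˡ (right T₁) (right T₂) (to i₁) (to i₂) x j) (⊕-cong r₁ r₂ x j))

relate : ∀ {n l} → (Fin n → Sub l) → (Fin l → Fin l → Bool) → Fin n → Fin n → Bool
relate {l = l} f R a a' = anyF l (λ y → anyF l (λ y' → f a y ∧ f a' y' ∧ R y y'))

relate-intro : ∀ {n l} (f : Fin n → Sub l) (R : Fin l → Fin l → Bool) {a a' y y'} →
  Holds (f a y) → Holds (f a' y') → Holds (R y y') → Holds (relate f R a a')
relate-intro {l = l} f R {a} {a'} {y} {y'} p q r =
  anyF-intro l _ y (anyF-intro l (λ w → f a y ∧ f a' w ∧ R y w) y' (∧-intro p (∧-intro q r)))

relate-elim : ∀ {n l} (f : Fin n → Sub l) (R : Fin l → Fin l → Bool) {a a'} →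
  Holds (relate f R a a') →
  Σ (Fin l) λ y → Σ (Fin l) λ y' → Holds (f a y) × Holds (f a' y') × Holds (R y y')
relate-elim {l = l} f R {a} {a'} p with anyF-elim l _ p
... | y , q with anyF-elim l _ q
...   | y' , r =
  y , y' , ∧-elimˡ r , ∧-elimˡ (∧-elimʳ {f a y} r) , ∧-elimʳ {f a' y'} (∧-elimʳ {f a y} r)

relate-ι : ∀ {n} (R : Fin n → Fin n → Bool) x x' → relate (ι n) R x x' ≡ R x x'
relate-ι {n} R x x' = bool-ext
  (λ p → let (y , y' , x≡y , x'≡y' , Ryy') = relate-elim (ι n) R p in
     subst₂ (λ u v → Holds (R u v)) (sym (≟-sound x≡y)) (sym (≟-sound x'≡y')) Ryy')
  (relate-intro (ι n) R (≟-refl x) (≟-refl x'))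

module IdentityPullback {l : ℕ} (A : CSet) (R : Fin l → Fin l → Bool) (f : RArr A (disc l)) where

  B : CSet
  B = cset l R

  P : CSet
  P = cset (size A) (λ a a' → con A a a' ∨ relate f R a a')

  π₁ : RArr P A
  π₁ = ι (size A)

  π₂ : RArr P B
  π₂ = f

  module _ (wA : IsCSet A) (wB : IsCSet B) (af : IsArr A (disc l) f)
           (f-sparse : ∀ a y y' → Holds (f a y) → Holds (f a y') → Holds (R y y') → y ≡ y') where

    P-sym : ∀ a a' → Holds (con P a a') → Holds (con P a' a)
    P-sym a a' p with ∨-elim {con A a a'} p
    ... | inj₁ c = ∨-introˡ (trans (proj₂ wA a' a) c)
    ... | inj₂ c = let (y , y' , fay , fa'y' , Ryy') = relate-elim f R c in
                   ∨-introʳ {con A a' a} (relate-intro f R fa'y' fay (trans (proj₂ wB y' y) Ryy'))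

    P-isCSet : IsCSet P
    P-isCSet = (λ a → ∨-introˡ (proj₁ wA a)) , (λ a a' → bool-ext (P-sym a a') (P-sym a' a))

    π₁-isArr : IsArr P A π₁
    π₁-isArr = proj₁ graph , λ x x' c → ∨-introˡ (proj₂ graph x x' c)
      where graph = graph-isArr (CIso-refl A)

    π₂-isArr : IsArr P B π₂
    π₂-isArr = f-sparse , λ x x' (u , v , p , q , r) → ∨-introʳ {con A x x'} (relate-intro f R p q r)

    isPullback : IsPullback {A} {B} {disc l} f (ι l) P π₁ π₂
    isPullback = commutes , universal
      where
      commutes : f ∘R π₁ ≈R ι l ∘R π₂
      commutes a j = trans (sharp-singleton f a j) (sym (sharp-ι l (f a) j))

      -- A cone (q₁, q₂) factors through q₁ itself, since q₂ is forced to be f ∘ q₁.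
      universal : (Z : CSet) → IsCSet Z → (q₁ : RArr Z A) (q₂ : RArr Z B) →
        IsArr Z A q₁ → IsArr Z B q₂ → f ∘R q₁ ≈R ι l ∘R q₂ →
        Σ (RArr Z P) λ u → IsArr Z P u × (π₁ ∘R u ≈R q₁) × (π₂ ∘R u ≈R q₂) ×
          ((u' : RArr Z P) → IsArr Z P u' → π₁ ∘R u' ≈R q₁ → π₂ ∘R u' ≈R q₂ → u' ≈R u)
      universal Z _ q₁ q₂ (q₁-indep , q₁-mor) (q₂-indep , q₂-mor) cm =
        q₁ , (indep , mor) , (λ z a → sharp-ι (size A) (q₁ z) a) , q₂-forced ,
        (λ u' _ e _ z a → trans (sym (sharp-ι (size A) (u' z) a)) (e z a))
        where
        q₂-forced : f ∘R q₁ ≈R q₂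
        q₂-forced z y = trans (cm z y) (sharp-ι l (q₂ z) y)

        reach : ∀ {z u y} → Holds (q₁ z u) → Holds (f u y) → Holds (q₂ z y)
        reach {z} p q = subst Holds (q₂-forced z _) (sharp-intro f (q₁ z) p q)

        indep : ∀ z → Independent P (q₁ z)
        indep z u v p q c with ∨-elim {con A u v} c
        ... | inj₁ c' = q₁-indep z u v p q c'
        ... | inj₂ c' =
          let (y , y' , fuy , fvy' , Ryy') = relate-elim f R c'
              y≡y' = q₂-indep z y y' (reach p fuy) (reach q fvy') Ryy'
              fvy = subst (λ w → Holds (f v w)) (sym y≡y') fvy'
          in q₁-indep z u v p q (proj₂ af u v (y , y , fuy , fvy , ≟-refl y))

        mor : ∀ z z' → PCon P (q₁ z) (q₁ z') → Holds (con Z z z')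
        mor z z' (u , v , p , q , c) with ∨-elim {con A u v} c
        ... | inj₁ c' = q₁-mor z z' (u , v , p , q , c')
        ... | inj₂ c' =
          let (y , y' , fuy , fvy' , Ryy') = relate-elim f R c'
          in q₂-mor z z' (y , y' , reach p fuy , reach q fvy' , Ryy')

pullback-sym : ∀ {A B C} {f : RArr A C} {g : RArr B C} {P} {p₁ : RArr P A} {p₂ : RArr P B} →
  IsPullback {A} {B} {C} f g P p₁ p₂ → IsPullback {B} {A} {C} g f P p₂ p₁
pullback-sym (cm , univ) = (λ x j → sym (cm x j)) ,
  λ Z wZ q₂ q₁ a₂ a₁ c →
    let (u , au , e₁ , e₂ , uniq) = univ Z wZ q₁ q₂ a₁ a₂ (λ z j → sym (c z j))
    in u , au , e₂ , e₁ , (λ u' au' e₂' e₁' → uniq u' au' e₁' e₂')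

isArr-along : ∀ {C Y' Y} (i : CIso Y' Y) (h : RArr C Y') → IsArr C Y' h →
  IsArr C Y (λ x y → h x (from i y))
isArr-along {Y' = Y'} {Y} i h (h-indep , h-mor) =
  (λ x u v p q c →
     trans (sym (to-from i u)) (trans (cong (to i) (h-indep x _ _ p q (reflect c))) (to-from i v))) ,
  (λ x x' (u , v , p , q , c) → h-mor x x' (from i u , from i v , p , q , reflect c))
  where
  reflect : ∀ {u v} → Holds (con Y u v) → Holds (con Y' (from i u) (from i v))
  reflect {u} {v} c =
    trans (sym (to-con i (from i u) (from i v))) (trans (cong₂ (con Y) (to-from i u) (to-from i v)) c)

sharp-along : ∀ {Y' Y m} (i : CIso Y' Y) (U : Sub (size Y))
  (k : Fin (size Y) → Sub m) (k' : Fin (size Y') → Sub m) →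
  (λ y → k (to i y)) ≈R k' → ∀ z → sharp k' (U ∘ to i) z ≡ sharp k U z
sharp-along {Y'} i U k k' ek z =
  trans (anyF-cong (size Y') (λ y → cong (U (to i y) ∧_) (sym (ek y z))))
        (anyF-reindex (to i) (from i) (to-from i) (λ y → U y ∧ k y z))

pullback-alongˡ : ∀ {A' A B C : CSet} {f : RArr A C} {g : RArr B C} {P : CSet}
  {p₁ : RArr P A} {p₂ : RArr P B} (i : CIso A' A) (f' : RArr A' C) →
  (λ x → f (to i x)) ≈R f' →
  IsPullback {A} {B} {C} f g P p₁ p₂ → IsPullback {A'} {B} {C} f' g P (λ z a → p₁ z (to i a)) p₂
pullback-alongˡ {A'} {A} {B} {f = f} {g} {P} {p₁} {p₂} i f' ef (cm , univ) = commutes , universal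
  where
  commutes : f' ∘R (λ z a → p₁ z (to i a)) ≈R g ∘R p₂
  commutes x j = trans (sharp-along i (p₁ x) f f' ef j) (cm x j)

  f'-along-from : (λ y → f' (from i y)) ≈R f
  f'-along-from y j = trans (sym (ef (from i y) j)) (cong (λ w → f w j) (to-from i y))

  universal : (Z : CSet) → IsCSet Z → (q₁' : RArr Z A') (q₂ : RArr Z B) →
    IsArr Z A' q₁' → IsArr Z B q₂ → f' ∘R q₁' ≈R g ∘R q₂ →
    Σ (RArr Z P) λ u → IsArr Z P u × ((λ z a → sharp (λ w t → p₁ w (to i t)) (u z) a) ≈R q₁') ×
      (p₂ ∘R u ≈R q₂) ×
      ((u' : RArr Z P) → IsArr Z P u' → (λ z a → sharp (λ w t → p₁ w (to i t)) (u' z) a) ≈R q₁' →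
         p₂ ∘R u' ≈R q₂ → u' ≈R u)
  universal Z wZ q₁' q₂ a₁' a₂ c' =
    let (u , au , e₁ , e₂ , uniq) = univ Z wZ q₁ q₂ (isArr-along i q₁' a₁') a₂ c
    in u , au ,
       (λ z a → trans (e₁ z (to i a)) (cong (q₁' z) (from-to i a))) , e₂ ,
       (λ u' au' e₁' e₂' → uniq u' au' (restrict u' e₁') e₂')
    where
    q₁ : RArr Z A
    q₁ z a = q₁' z (from i a)
    c : f ∘R q₁ ≈R g ∘R q₂
    c z j = trans (sharp-along (CIso-sym i) (q₁' z) f' f f'-along-from j) (c' z j)
    restrict : (u' : RArr Z P) → (λ z a → sharp (λ w t → p₁ w (to i t)) (u' z) a) ≈R q₁' →
      p₁ ∘R u' ≈R q₁
    restrict u' e z a =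
      trans (anyF-cong (size P) (λ w → cong (λ t → u' z w ∧ p₁ w t) (sym (to-from i a))))
            (e z (from i a))

pullback-alongʳ : ∀ {A B' B C : CSet} {f : RArr A C} {g : RArr B C} {P : CSet}
  {p₁ : RArr P A} {p₂ : RArr P B} (i : CIso B' B) (g' : RArr B' C) →
  (λ x → g (to i x)) ≈R g' →
  IsPullback {A} {B} {C} f g P p₁ p₂ → IsPullback {A} {B'} {C} f g' P p₁ (λ z b → p₂ z (to i b))
pullback-alongʳ {A} {B'} {B} {C} {f} {g} {P} {p₁} {p₂} i g' eg pb =
  pullback-sym {B'} {A} {C} {g'} {f} {P} {λ z b → p₂ z (to i b)} {p₁}
    (pullback-alongˡ {B'} {B} {A} {C} {g} {f} {P} {p₂} {p₁} i g' eg
      (pullback-sym {A} {B} {C} {f} {g} {P} {p₁} {p₂} pb))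

denotes-⨾ : ∀ {k l m} {e₁ : Expr k l} {e₂ : Expr l m} {S₁ T₁ : Span k l} {S₂ T₂ : Span l m} →
  Denotes e₁ S₁ → SpanIso S₁ T₁ → Denotes e₂ S₂ → SpanIso S₂ T₂ →
  (P : CSet) (p₁ : RArr P (carrier T₁)) (p₂ : RArr P (carrier T₂)) → IsCSet P →
  IsArr P (carrier T₁) p₁ → IsArr P (carrier T₂) p₂ →
  IsPullback {carrier T₁} {carrier T₂} {disc l} (right T₁) (left T₂) P p₁ p₂ →
  Σ (Span k m) λ S → Denotes (e₁ ⨾ e₂) S × SpanIso S (span P (left T₁ ∘R p₁) (right T₂ ∘R p₂))
denotes-⨾ {S₁ = S₁} {T₁} {S₂} {T₂} D₁ (spanIso i₁ l₁ r₁) D₂ (spanIso i₂ l₂ r₂)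
          P p₁ p₂ wP a₁ a₂ pb =
  span P (left S₁ ∘R p₁') (right S₂ ∘R p₂') ,
  d⨾ D₁ D₂ P p₁' p₂' wP (isArr-along (CIso-sym i₁) p₁ a₁) (isArr-along (CIso-sym i₂) p₂ a₂)
     (pullback-alongʳ {C = disc _} {f = right S₁} {g = left T₂} {P = P} {p₁ = p₁'} {p₂}
        i₂ (left S₂) l₂
       (pullback-alongˡ {C = disc _} {f = right T₁} {g = left T₂} {P = P} {p₁ = p₁} {p₂}
          i₁ (right S₁) r₁ pb)) ,
  SpanIso-pointwise P (λ _ _ → refl)
    (λ x j → sharp-along i₁ (p₁ x) (left T₁) (left S₁) l₁ j)
    (λ x j → sharp-along i₂ (p₂ x) (right T₂) (right S₂) r₂ j)
  where
  p₁' : RArr P (carrier S₁)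
  p₁' z a = p₁ z (to i₁ a)
  p₂' : RArr P (carrier S₂)
  p₂' z b = p₂ z (to i₂ b)

meets : ∀ {n m} → (Fin n → Sub m) → Fin n → Fin n → Bool
meets {m = m} c x x' = anyF m (λ z → c x z ∧ c x' z)

meets-intro : ∀ {n m} (c : Fin n → Sub m) {x x' z} →
  Holds (c x z) → Holds (c x' z) → Holds (meets c x x')
meets-intro {m = m} c {x} {x'} {z} p q = anyF-intro m (λ w → c x w ∧ c x' w) z (∧-intro p q)

meets-elim : ∀ {n m} (c : Fin n → Sub m) {x x'} → Holds (meets c x x') →
  Σ (Fin m) λ z → Holds (c x z) × Holds (c x' z)
meets-elim {m = m} c {x} p = let (z , q) = anyF-elim m _ p in z , ∧-elimˡ q , ∧-elimʳ {c x z} q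

-- The least contention on n making c : n ⇸ m an arrow: equal points or images that meet.
conM : ∀ {n m} → (Fin n → Sub m) → Fin n → Fin n → Bool
conM c x x' = ⌊ x ≟ x' ⌋ ∨ meets c x x'

Minimal : ∀ {n m} → (Fin n → Sub m) → Span n m
Minimal {n} c = span (cset n (conM c)) (ι n) c

conM-refl : ∀ {n m} (c : Fin n → Sub m) {x x'} → x ≡ x' → Holds (conM c x x')
conM-refl c e = ∨-introˡ (≟-complete e)

conM-meets : ∀ {n m} (c : Fin n → Sub m) {x x' z} → Holds (c x z) → Holds (c x' z) → Holds (conM c x x')
conM-meets c {x} p q = ∨-introʳ {⌊ x ≟ _ ⌋} (meets-intro c p q)

conM-elim : ∀ {n m} (c : Fin n → Sub m) {x x'} → Holds (conM c x x') →
  (x ≡ x') ⊎ (Σ (Fin m) λ z → Holds (c x z) × Holds (c x' z))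
conM-elim c {x} p with ∨-elim {⌊ x ≟ _ ⌋} p
... | inj₁ q = inj₁ (≟-sound q)
... | inj₂ q = inj₂ (meets-elim c q)

conM-cong : ∀ {n m} {b b' : Fin n → Sub m} → b ≈R b' → conM b ≈R conM b'
conM-cong e x x' = cong (⌊ x ≟ x' ⌋ ∨_) (bool-ext (transfer e) (transfer (λ y j → sym (e y j))))
  where
  transfer : ∀ {c c'} → c ≈R c' → Holds (meets c x x') → Holds (meets c' x x')
  transfer {c} {c'} e' p =
    let (z , q , r) = meets-elim c p in meets-intro c' (trans (sym (e' x z)) q) (trans (sym (e' x' z)) r)

conM-sym : ∀ {n m} (c : Fin n → Sub m) x x' → Holds (conM c x x') → Holds (conM c x' x)
conM-sym c x x' p with conM-elim c p
... | inj₁ e           = conM-refl c (sym e)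
... | inj₂ (z , q , r) = conM-meets c r q

Minimal-isCSet : ∀ {n m} (c : Fin n → Sub m) → IsCSet (carrier (Minimal c))
Minimal-isCSet c = (λ x → conM-refl c refl) , (λ x x' → bool-ext (conM-sym c x x') (conM-sym c x' x))

Minimal-left : ∀ {n m} (c : Fin n → Sub m) → IsArr (carrier (Minimal c)) (disc n) (ι n)
Minimal-left {n} c =
  (λ _ _ _ _ _ u≡v → ≟-sound u≡v) ,
  (λ x x' (u , v , p , q , r) → conM-refl c (trans (≟-sound p) (trans (≟-sound r) (sym (≟-sound q)))))

Minimal-right : ∀ {n m} (c : Fin n → Sub m) → IsArr (carrier (Minimal c)) (disc m) c
Minimal-right c =
  (λ _ _ _ _ _ u≡v → ≟-sound u≡v) ,
  (λ x x' (u , v , p , q , r) → conM-meets c p (subst (λ w → Holds (c x' w)) (sym (≟-sound r)) q))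

-- Composing a span T with a minimal span only enlarges the contention of T's carrier.
_⨾M_ : ∀ {k l m} → Span k l → (Fin l → Sub m) → Span k m
T ⨾M c = span (IdentityPullback.P (carrier T) (conM c) (right T)) (left T) (c ∘R right T)

denotes-⨾M : ∀ {k l m} {e₁ : Expr k l} {e₂ : Expr l m} {S₁ : Span k l} {S₂ : Span l m}
  (T : Span k l) (c : Fin l → Sub m) →
  Denotes e₁ S₁ → SpanIso S₁ T → IsCSet (carrier T) → IsArr (carrier T) (disc l) (right T) →
  Denotes e₂ S₂ → SpanIso S₂ (Minimal c) →
  (∀ a y y' → Holds (right T a y) → Holds (right T a y') → Holds (conM c y y') → y ≡ y') →
  Σ (Span k m) λ S → Denotes (e₁ ⨾ e₂) S × SpanIso S (T ⨾M c)
denotes-⨾M T c D₁ iso₁ wT aT D₂ iso₂ sparse =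
  let (S , D , iso) = denotes-⨾ D₁ iso₁ D₂ iso₂ P π₁ π₂ (P-isCSet wT wB aT sparse)
                        (π₁-isArr wT wB aT sparse) (π₂-isArr wT wB aT sparse) (isPullback wT wB aT sparse)
  in S , D , SpanIso-trans iso
       (SpanIso-pointwise P (λ _ _ → refl) (λ x j → sharp-singleton (left T) x j) (λ _ _ → refl))
  where
  open IdentityPullback (carrier T) (conM c) (right T)
  wB : IsCSet B
  wB = Minimal-isCSet c

data Split (m n : ℕ) : Fin (m + n) → Set where
  inl : (i : Fin m) → Split m n (i ↑ˡ n)
  inr : (j : Fin n) → Split m n (m ↑ʳ j)

split : ∀ m n x → Split m n x
split m n x with splitAt m x in eq
... | inj₁ i = subst (Split m n) (splitAt⁻¹-↑ˡ eq) (inl i)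
... | inj₂ j = subst (Split m n) (splitAt⁻¹-↑ʳ eq) (inr j)

↑ˡ≢↑ʳ : ∀ {m n} (i : Fin m) (j : Fin n) → i ↑ˡ n ≡ m ↑ʳ j → {A : Set} → A
↑ˡ≢↑ʳ {m} {n} i j e
  with trans (sym (splitAt-↑ˡ m i n)) (trans (cong (splitAt m) e) (splitAt-↑ʳ m n j))
... | ()

module _ {a b c d : ℕ} (r : Fin a → Fin b → Bool) (s : Fin c → Fin d → Bool) where
  ⊕-inl-inl : ∀ i j → (r ⊕ s) (i ↑ˡ c) (j ↑ˡ d) ≡ r i j
  ⊕-inl-inl i j rewrite splitAt-↑ˡ a i c | splitAt-↑ˡ b j d = refl
  ⊕-inl-inr : ∀ i j → (r ⊕ s) (i ↑ˡ c) (b ↑ʳ j) ≡ false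
  ⊕-inl-inr i j rewrite splitAt-↑ˡ a i c | splitAt-↑ʳ b d j = refl
  ⊕-inr-inl : ∀ i j → (r ⊕ s) (a ↑ʳ i) (j ↑ˡ d) ≡ false
  ⊕-inr-inl i j rewrite splitAt-↑ʳ a c i | splitAt-↑ˡ b j d = refl
  ⊕-inr-inr : ∀ i j → (r ⊕ s) (a ↑ʳ i) (b ↑ʳ j) ≡ s i j
  ⊕-inr-inr i j rewrite splitAt-↑ʳ a c i | splitAt-↑ʳ b d j = refl

ι-⊕ : ∀ n n' → (ι n ⊕ ι n') ≈R ι (n + n')
ι-⊕ n n' x y with split n n' x | split n n' y
... | inl i | inl j rewrite ⊕-inl-inl (ι n) (ι n') i j =
  sym (≟-injective (_↑ˡ n') (λ {u} {v} → ↑ˡ-injective n' u v) i j)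
... | inl i | inr j rewrite ⊕-inl-inr (ι n) (ι n') i j =
  bool-ext (λ ()) (λ p → ↑ˡ≢↑ʳ i j (≟-sound p))
... | inr i | inl j rewrite ⊕-inr-inl (ι n) (ι n') i j =
  bool-ext (λ ()) (λ p → ↑ˡ≢↑ʳ j i (sym (≟-sound p)))
... | inr i | inr j rewrite ⊕-inr-inr (ι n) (ι n') i j =
  sym (≟-injective (n ↑ʳ_) (λ {u} {v} → ↑ʳ-injective n u v) i j)

⊕-∨ : ∀ {a b c d} (r r' : Fin a → Fin b → Bool) (s s' : Fin c → Fin d → Bool) →
  ((λ x y → r x y ∨ r' x y) ⊕ (λ x y → s x y ∨ s' x y))
    ≈R (λ x y → (r ⊕ s) x y ∨ (r' ⊕ s') x y)
⊕-∨ {a} {b} r r' s s' x y with splitAt a x | splitAt b y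
... | inj₁ _ | inj₁ _ = refl
... | inj₁ _ | inj₂ _ = refl
... | inj₂ _ | inj₁ _ = refl
... | inj₂ _ | inj₂ _ = refl

meets-sym : ∀ {n m} (c : Fin n → Sub m) x x' → meets c x x' ≡ meets c x' x
meets-sym c x x' = bool-ext (swap x x') (swap x' x)
  where
  swap : ∀ u v → Holds (meets c u v) → Holds (meets c v u)
  swap u v p = let (z , q , r) = meets-elim c p in meets-intro c r q

module _ {n n' l l'} (b : Fin n → Sub l) (b' : Fin n' → Sub l') where

  meets-⊕-inl : ∀ i i' → meets (b ⊕ b') (i ↑ˡ n') (i' ↑ˡ n') ≡ meets b i i'
  meets-⊕-inl i i' = bool-ext forth back
    where
    forth : Holds (meets (b ⊕ b') (i ↑ˡ n') (i' ↑ˡ n')) → Holds (meets b i i')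
    forth p with meets-elim (b ⊕ b') p
    ... | z , q , r with split l l' z
    ...   | inl w = meets-intro b (trans (sym (⊕-inl-inl b b' i w)) q) (trans (sym (⊕-inl-inl b b' i' w)) r)
    ...   | inr w = refute (⊕-inl-inr b b' i w) q
    back : Holds (meets b i i') → Holds (meets (b ⊕ b') (i ↑ˡ n') (i' ↑ˡ n'))
    back p = let (z , q , r) = meets-elim b p in
      meets-intro (b ⊕ b') (trans (⊕-inl-inl b b' i z) q) (trans (⊕-inl-inl b b' i' z) r)

  meets-⊕-inr : ∀ j j' → meets (b ⊕ b') (n ↑ʳ j) (n ↑ʳ j') ≡ meets b' j j'
  meets-⊕-inr j j' = bool-ext forth back
    where
    forth : Holds (meets (b ⊕ b') (n ↑ʳ j) (n ↑ʳ j')) → Holds (meets b' j j')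
    forth p with meets-elim (b ⊕ b') p
    ... | z , q , r with split l l' z
    ...   | inl w = refute (⊕-inr-inl b b' j w) q
    ...   | inr w = meets-intro b' (trans (sym (⊕-inr-inr b b' j w)) q) (trans (sym (⊕-inr-inr b b' j' w)) r)
    back : Holds (meets b' j j') → Holds (meets (b ⊕ b') (n ↑ʳ j) (n ↑ʳ j'))
    back p = let (z , q , r) = meets-elim b' p in
      meets-intro (b ⊕ b') (trans (⊕-inr-inr b b' j z) q) (trans (⊕-inr-inr b b' j' z) r)

  meets-⊕-mixed : ∀ i j → meets (b ⊕ b') (i ↑ˡ n') (n ↑ʳ j) ≡ false
  meets-⊕-mixed i j = bool-ext forth (λ ())
    where
    forth : Holds (meets (b ⊕ b') (i ↑ˡ n') (n ↑ʳ j)) → Holds false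
    forth p with meets-elim (b ⊕ b') p
    ... | z , q , r with split l l' z
    ...   | inl w = refute (⊕-inr-inl b b' j w) r
    ...   | inr w = refute (⊕-inl-inr b b' i w) q

  meets-⊕ : (meets b ⊕ meets b') ≈R meets (b ⊕ b')
  meets-⊕ x x' with split n n' x | split n n' x'
  ... | inl i | inl i' = trans (⊕-inl-inl (meets b) (meets b') i i') (sym (meets-⊕-inl i i'))
  ... | inl i | inr j  = trans (⊕-inl-inr (meets b) (meets b') i j) (sym (meets-⊕-mixed i j))
  ... | inr j | inl i  = trans (⊕-inr-inl (meets b) (meets b') j i)
                               (sym (trans (meets-sym (b ⊕ b') _ _) (meets-⊕-mixed i j)))
  ... | inr j | inr j' = trans (⊕-inr-inr (meets b) (meets b') j j') (sym (meets-⊕-inr j j'))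

  conM-⊕ : (conM b ⊕ conM b') ≈R conM (b ⊕ b')
  conM-⊕ x x' = trans (⊕-∨ (ι n) (meets b) (ι n') (meets b') x x')
                      (cong₂ _∨_ (ι-⊕ n n' x x') (meets-⊕ x x'))

Expressible : ∀ {n l} → (Fin n → Sub l) → Set
Expressible {n} {l} b = Σ (Expr n l) λ e → Σ (Span n l) λ S → Denotes e S × SpanIso S (Minimal b)

expressible-cong : ∀ {n l} {b b' : Fin n → Sub l} → b ≈R b' → Expressible b → Expressible b'
expressible-cong {b = b} e (ex , S , D , iso) =
  ex , S , D , SpanIso-trans iso
                 (SpanIso-pointwise (carrier (Minimal b)) (conM-cong e) (λ _ _ → refl) e)

expressible-⊗ : ∀ {n l n' l'} {b : Fin n → Sub l} {b' : Fin n' → Sub l'} →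
  Expressible b → Expressible b' → Expressible (b ⊕ b')
expressible-⊗ {n} {_} {n'} {_} {b} {b'} (e₁ , S₁ , D₁ , iso₁) (e₂ , S₂ , D₂ , iso₂) =
  e₁ ⊗ e₂ , S₁ ⊗S S₂ , d⊗ D₁ D₂ ,
  SpanIso-trans (SpanIso-⊗ iso₁ iso₂)
    (SpanIso-pointwise (carrier (Minimal b ⊗S Minimal b')) (conM-⊕ b b') (ι-⊕ n n') (λ _ _ → refl))

expressible-⨾ : ∀ {n l m} {b : Fin n → Sub l} {c : Fin l → Sub m} (d : Fin n → Sub m) →
  Expressible b → Expressible c → c ∘R b ≈R d →
  (∀ x y y' → Holds (b x y) → Holds (b x y') → Holds (conM c y y') → y ≡ y') →
  (∀ x x' → Holds (meets b x x') → Holds (conM d x x')) →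
  Expressible d
expressible-⨾ {l = l} {b = b} {c} d (e₁ , _ , D₁ , iso₁) (e₂ , _ , D₂ , iso₂) cb≈d sparse meet =
  let (S , D , iso) =
        denotes-⨾M (Minimal b) c D₁ iso₁ (Minimal-isCSet b) (Minimal-right b) D₂ iso₂ sparse
  in e₁ ⨾ e₂ , S , D ,
     SpanIso-trans iso
       (SpanIso-pointwise (carrier (Minimal b ⨾M c)) con≈ (λ _ _ → refl) cb≈d)
  where
  d-intro : ∀ {x y z} → Holds (b x y) → Holds (c y z) → Holds (d x z)
  d-intro {x} {y} {z} p q = subst Holds (cb≈d x z) (sharp-intro c (b x) p q)

  d-elim : ∀ {x z} → Holds (d x z) → Σ (Fin l) λ y → Holds (b x y) × Holds (c y z)
  d-elim {x} {z} p = sharp-elim c (b x) (subst Holds (sym (cb≈d x z)) p)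

  con≈ : (λ x x' → conM b x x' ∨ relate b (conM c) x x') ≈R conM d
  con≈ x x' = bool-ext forth back
    where
    forth : Holds (conM b x x' ∨ relate b (conM c) x x') → Holds (conM d x x')
    forth p with ∨-elim {conM b x x'} p
    ... | inj₁ q with conM-elim b q
    ...   | inj₁ e = conM-refl d e
    ...   | inj₂ (_ , r , s) = meet x x' (meets-intro b r s)
    forth p | inj₂ q with relate-elim b (conM c) q
    ... | y , y' , bxy , bx'y' , cyy' with conM-elim c cyy'
    ...   | inj₁ refl = meet x x' (meets-intro b bxy bx'y')
    ...   | inj₂ (_ , r , s) = conM-meets d (d-intro bxy r) (d-intro bx'y' s)
    back : Holds (conM d x x') → Holds (conM b x x' ∨ relate b (conM c) x x')
    back p with conM-elim d p
    ... | inj₁ e = ∨-introˡ (conM-refl b e)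
    ... | inj₂ (_ , r , s) =
      let (y , bxy , cy) = d-elim r
          (y' , bx'y' , cy') = d-elim s
      in ∨-introʳ {conM b x x'} (relate-intro b (conM c) bxy bx'y' (conM-meets c cy cy'))

≟-suc : ∀ {n} (x y : Fin n) → ⌊ suc x ≟ suc y ⌋ ≡ ⌊ x ≟ y ⌋
≟-suc = ≟-injective suc suc-injective

generator : ∀ {n l} {e : Expr n l} {c : Fin n → Fin n → Bool} {a : Fin n → Sub n} {b : Fin n → Sub l} →
  Denotes e (span (cset n c) a b) → c ≈R conM b → a ≈R ι n → Expressible b
generator {n} {c = c} D ec ea = _ , _ , D , SpanIso-pointwise (cset n c) ec ea (λ _ _ → refl)

expressible-I : Expressible (ι 1)
expressible-I = expressible-cong (λ { zero zero → refl })
  (generator dI (λ { zero zero → refl }) (λ { zero zero → refl }))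

exchange : Fin 2 → Sub 2
exchange i j = ⌊ opposite i ≟ j ⌋

expressible-X : Expressible exchange
expressible-X = generator dX
  (λ { zero zero → refl ; zero (suc zero) → refl ; (suc zero) zero → refl ; (suc zero) (suc zero) → refl })
  (λ _ _ → refl)

expressible-Δ : Expressible (allR {1} {2})
expressible-Δ = generator dΔ (λ { zero zero → refl }) (λ { zero zero → refl })

expressible-V : Expressible (allR {2} {1})
expressible-V = generator dV
  (λ { zero zero → refl ; zero (suc zero) → refl ; (suc zero) zero → refl ; (suc zero) (suc zero) → refl })
  (λ _ _ → refl)

expressible-⊥ : Expressible (noneR0 {1})
expressible-⊥ = generator d⊥ (λ { zero zero → refl }) (λ { zero zero → refl })

from∅ : ∀ {m} → Fin 0 → Sub m
from∅ ()

expressible-↑ : Expressible (from∅ {1})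
expressible-↑ = expressible-cong (λ ())
  (generator d↑ (λ ()) (λ ()))

expressible-∅ : Expressible (from∅ {0})
expressible-∅ = expressible-⨾ from∅ expressible-↑ expressible-⊥
  (λ ()) (λ ()) (λ ())

expressible-ι : ∀ l → Expressible (ι l)
expressible-ι zero    = expressible-cong (λ ()) expressible-∅
expressible-ι (suc l) =
  expressible-cong (ι-⊕ 1 l) (expressible-⊗ expressible-I (expressible-ι l))

expressible-from∅ : ∀ l → Expressible (from∅ {l})
expressible-from∅ zero    = expressible-∅
expressible-from∅ (suc l) = expressible-cong (λ ())
  (expressible-⊗ expressible-↑ (expressible-from∅ l))

expressible-discard : ∀ n → Expressible (noneR0 {n})
expressible-discard zero    = expressible-cong (λ ()) expressible-∅
expressible-discard (suc n) = expressible-cong (λ _ ())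
  (expressible-⊗ expressible-⊥ (expressible-discard n))

expressible-reindex : ∀ {n l m} {b : Fin n → Sub l} {c : Fin l → Sub m} (d : Fin n → Sub m)
  (σ : Fin n → Fin l) (τ : Fin l → Fin n) → (∀ x → τ (σ x) ≡ x) →
  (∀ x → b x ≗ ι l (σ x)) → (∀ x → c (σ x) ≗ d x) →
  Expressible b → Expressible c → Expressible d
expressible-reindex {b = b} {c} d σ τ τσ b≈σ cσ≈d eb ec =
  expressible-⨾ d eb ec (λ x z → trans (sharp-point b c x (σ x) (b≈σ x) z) (cσ≈d x z))
    (λ x y y' p q _ → trans (image p) (sym (image q)))
    (λ x x' p → let (_ , q , r) = meets-elim b p in
       conM-refl d (trans (sym (τσ x)) (trans (cong τ (trans (sym (image q)) (image r))) (τσ x'))))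
  where
  image : ∀ {x y} → Holds (b x y) → y ≡ σ x
  image {x} {y} p = sym (≟-sound (trans (sym (b≈σ x y)) p))

ι-⊕-lift : ∀ {n m} (g : Fin n → Sub m) (σ : Fin n → Fin m) →
  (∀ x → g x ≗ ι m (σ x)) → ∀ x → (ι 1 ⊕ g) x ≗ ι (suc m) (lift 1 σ x)
ι-⊕-lift g σ e zero    zero    = refl
ι-⊕-lift g σ e zero    (suc y) = refl
ι-⊕-lift g σ e (suc x) zero    = refl
ι-⊕-lift g σ e (suc x) (suc y) = trans (e x y) (sym (≟-suc (σ x) y))

swap₀₁ : ∀ {l} → Fin (2 + l) → Fin (2 + l)
swap₀₁ zero          = suc zero
swap₀₁ (suc zero)    = zero
swap₀₁ (suc (suc x)) = suc (suc x)

swap₀₁-involutive : ∀ {l} (x : Fin (2 + l)) → swap₀₁ (swap₀₁ x) ≡ x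
swap₀₁-involutive zero          = refl
swap₀₁-involutive (suc zero)    = refl
swap₀₁-involutive (suc (suc x)) = refl

exchange-⊕-ι : ∀ l x → (exchange ⊕ ι l) x ≗ ι (2 + l) (swap₀₁ x)
exchange-⊕-ι l zero          zero          = refl
exchange-⊕-ι l zero          (suc zero)    = refl
exchange-⊕-ι l zero          (suc (suc y)) = refl
exchange-⊕-ι l (suc zero)    zero          = refl
exchange-⊕-ι l (suc zero)    (suc zero)    = refl
exchange-⊕-ι l (suc zero)    (suc (suc y)) = refl
exchange-⊕-ι l (suc (suc x)) zero          = refl
exchange-⊕-ι l (suc (suc x)) (suc zero)    = refl
exchange-⊕-ι l (suc (suc x)) (suc (suc y)) = sym (trans (≟-suc (suc x) (suc y)) (≟-suc x y))

adjoin : ∀ l → Sub l → Fin (suc l) → Sub l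
adjoin l c zero    = c
adjoin l c (suc i) = ι l i

-- If 0 ∉ c, first exchange the new point with point 0, which then passes through unchanged:
--   adjoin (1 + l) c = (X ⊗ id) ; (I ⊗ adjoin l c').
adjoin-skip : ∀ l (c : Sub (suc l)) → c zero ≡ false →
  Expressible (adjoin l (c ∘ suc)) → Expressible (adjoin (suc l) c)
adjoin-skip l c c₀ e =
  expressible-reindex (adjoin (suc l) c) swap₀₁ swap₀₁ swap₀₁-involutive (exchange-⊕-ι l) pass
    (expressible-⊗ expressible-X (expressible-ι l)) (expressible-⊗ expressible-I e)
  where
  pass : ∀ x → (ι 1 ⊕ adjoin l (c ∘ suc)) (swap₀₁ x) ≗ adjoin (suc l) c x
  pass zero          zero    = sym c₀
  pass zero          (suc z) = refl
  pass (suc zero)    zero    = refl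
  pass (suc zero)    (suc z) = refl
  pass (suc (suc x)) zero    = refl
  pass (suc (suc x)) (suc z) = sym (≟-suc x z)

-- The gadget used when 0 ∈ c, on inputs (copy, copy, point 0, other points): the first
-- copy is merged by V with point 0 (so the two contend), the second is adjoined to the
-- other points:  merge-copies = (I ⊗ X ⊗ id) ; (V ⊗ adjoin l c').
merge-copies : ∀ l → Sub l → Fin (3 + l) → Sub (suc l)
merge-copies l c' x = (allR {2} {1} ⊕ adjoin l c') (lift 1 swap₀₁ x)

expressible-merge-copies : ∀ l (c' : Sub l) → Expressible (adjoin l c') → Expressible (merge-copies l c')
expressible-merge-copies l c' e =
  expressible-reindex (merge-copies l c') (lift 1 swap₀₁) (lift 1 swap₀₁) lift-involutive
    (ι-⊕-lift (exchange ⊕ ι l) swap₀₁ (exchange-⊕-ι l)) (λ _ _ → refl)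
    (expressible-⊗ expressible-I (expressible-⊗ expressible-X (expressible-ι l)))
    (expressible-⊗ expressible-V e)
  where
  lift-involutive : ∀ x → lift 1 swap₀₁ (lift 1 swap₀₁ x) ≡ x
  lift-involutive zero    = refl
  lift-involutive (suc x) = cong suc (swap₀₁-involutive x)

-- If 0 ∈ c, duplicate the new point with Δ and merge the copies:
--   adjoin (1 + l) c = (Δ ⊗ id) ; merge-copies.
adjoin-copy : ∀ l (c : Sub (suc l)) → c zero ≡ true →
  Expressible (adjoin l (c ∘ suc)) → Expressible (adjoin (suc l) c)
adjoin-copy l c c₀ e =
  expressible-⨾ (adjoin (suc l) c) (expressible-⊗ expressible-Δ (expressible-ι (suc l)))
    (expressible-merge-copies l (c ∘ suc) e) composite sparse
    (λ x x' p → let (y , q , r) = meets-elim duplicate {x} {x'} p in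
       conM-refl (adjoin (suc l) c) (disjoint x x' y q r))
  where
  duplicate : Fin (suc (suc l)) → Sub (2 + suc l)
  duplicate = allR {1} {2} ⊕ ι (suc l)

  duplicate-suc : ∀ x y → duplicate (suc x) y ≡ ι (2 + suc l) (suc (suc x)) y
  duplicate-suc x zero          = refl
  duplicate-suc x (suc zero)    = refl
  duplicate-suc x (suc (suc y)) = sym (trans (≟-suc (suc x) (suc y)) (≟-suc x y))

  image-suc : ∀ x y → Holds (duplicate (suc x) y) → y ≡ suc (suc x)
  image-suc x y p = sym (≟-sound (trans (sym (duplicate-suc x y)) p))

  merged : ∀ x → merge-copies l (c ∘ suc) (suc (suc x)) ≗ adjoin (suc l) c (suc x)
  merged zero    zero    = refl
  merged zero    (suc z) = refl
  merged (suc i) zero    = refl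
  merged (suc i) (suc z) = sym (≟-suc i z)

  composite : merge-copies l (c ∘ suc) ∘R duplicate ≈R adjoin (suc l) c
  composite zero    zero    = sym c₀
  composite zero    (suc z) = trans (cong (c (suc z) ∨_) (anyF-false (suc l))) (∨-identityʳ _)
  composite (suc x) z       =
    trans (sharp-point duplicate (merge-copies l (c ∘ suc)) (suc x) (suc (suc x)) (duplicate-suc x) z)
          (merged x z)

  disjoint : ∀ x x' y → Holds (duplicate x y) → Holds (duplicate x' y) → x ≡ x'
  disjoint zero    zero     y p q = refl
  disjoint zero    (suc x') y p q with image-suc x' y q
  disjoint zero    (suc x') .(suc (suc x')) () q | refl
  disjoint (suc x) zero     y p q with image-suc x y p
  disjoint (suc x) zero     .(suc (suc x)) p () | refl
  disjoint (suc x) (suc x') y p q =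
    cong suc (suc-injective (suc-injective (trans (sym (image-suc x y p)) (image-suc x' y q))))

  -- The two copies of the new point are not in contention after merging.
  sparse : ∀ x y y' → Holds (duplicate x y) → Holds (duplicate x y') →
    Holds (conM (merge-copies l (c ∘ suc)) y y') → y ≡ y'
  sparse (suc x) y y' p q _ = trans (image-suc x y p) (sym (image-suc x y' q))
  sparse zero zero       zero       _ _ _ = refl
  sparse zero (suc zero) (suc zero) _ _ _ = refl
  sparse zero zero       (suc zero) _ _ r with conM-elim (merge-copies l (c ∘ suc)) {zero} {suc zero} r
  ... | inj₁ ()
  ... | inj₂ (zero , _ , ())
  ... | inj₂ (suc z , () , _)
  sparse zero (suc zero) zero _ _ r with conM-elim (merge-copies l (c ∘ suc)) {suc zero} {zero} r
  ... | inj₁ ()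
  ... | inj₂ (zero , () , _)
  ... | inj₂ (suc z , _ , ())
  sparse zero (suc (suc y)) _             () _ _
  sparse zero zero          (suc (suc y)) _ () _
  sparse zero (suc zero)    (suc (suc y)) _ () _

expressible-adjoin : ∀ l (c : Sub l) → Expressible (adjoin l c)
expressible-adjoin zero    c = expressible-cong (λ _ ()) expressible-⊥
expressible-adjoin (suc l) c with c zero in c₀
... | false = adjoin-skip l c c₀ (expressible-adjoin l (c ∘ suc))
... | true  = adjoin-copy l c c₀ (expressible-adjoin l (c ∘ suc))

-- Every minimal span is expressible: b = (I ⊗ b') ; adjoin l (b 0), where b' = b ∘ suc.
expressible-minimal : ∀ n l (b : Fin n → Sub l) → Expressible b
expressible-minimal zero    l b = expressible-cong (λ ()) (expressible-from∅ l)
expressible-minimal (suc n) l b =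
  expressible-⨾ b (expressible-⊗ expressible-I (expressible-minimal n l (b ∘ suc)))
    (expressible-adjoin l (b zero)) composite sparse meet
  where
  first : Fin (suc n) → Sub (suc l)
  first = ι 1 ⊕ (b ∘ suc)

  composite : adjoin l (b zero) ∘R first ≈R b
  composite zero    z = trans (cong (b zero z ∨_) (anyF-false l)) (∨-identityʳ _)
  composite (suc x) z = sharp-ι l (b (suc x)) z

  sparse : ∀ x y y' → Holds (first x y) → Holds (first x y') →
    Holds (conM (adjoin l (b zero)) y y') → y ≡ y'
  sparse zero    zero    zero     _ _ _ = refl
  sparse zero    zero    (suc y') _ () _
  sparse zero    (suc y) _        () _ _
  sparse (suc x) zero    _        () _ _
  sparse (suc x) (suc y) zero     _ () _
  sparse (suc x) (suc y) (suc y') _ _ r with conM-elim (adjoin l (b zero)) r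
  ... | inj₁ e           = e
  ... | inj₂ (z , p , q) = cong suc (trans (≟-sound p) (sym (≟-sound q)))

  meet : ∀ x x' → Holds (meets first x x') → Holds (conM b x x')
  meet x x' p with meets-elim first {x} {x'} p
  meet zero    zero     _ | _ = conM-refl b {zero} refl
  meet zero    (suc x') _ | zero    , _  , ()
  meet zero    (suc x') _ | suc j   , () , _
  meet (suc x) zero     _ | zero    , () , _
  meet (suc x) zero     _ | suc j   , _  , ()
  meet (suc x) (suc x') _ | zero    , () , _
  meet (suc x) (suc x') _ | suc j   , q  , r = conM-meets b {suc x} {suc x'} {j} q r

transposeE : ∀ {k l} → Expr k l → Expr l k
transposeE Δ       = ∇
transposeE ⊥e      = ⊤e
transposeE ∇       = Δ
transposeE ⊤e      = ⊥e
transposeE Λ       = V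
transposeE ↓e      = ↑e
transposeE V       = Λ
transposeE ↑e      = ↓e
transposeE I       = I
transposeE X       = X
transposeE (e ⨾ f) = transposeE f ⨾ transposeE e
transposeE (e ⊗ f) = transposeE e ⊗ transposeE f

transposeS : ∀ {k l} → Span k l → Span l k
transposeS S = span (carrier S) (right S) (left S)

SpanIso-transpose : ∀ {k l} {S T : Span k l} → SpanIso S T → SpanIso (transposeS S) (transposeS T)
SpanIso-transpose (spanIso i el er) = spanIso i er el

-- X is its own mirror image, up to exchanging the two points of its carrier.
exchange-iso : CIso (disc 2) (disc 2)
exchange-iso = record { to = opposite ; from = opposite ; to-from = involutive ; from-to = involutive
                      ; to-con = λ { zero zero → refl ; zero (suc zero) → refl
                                   ; (suc zero) zero → refl ; (suc zero) (suc zero) → refl } }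
  where
  involutive : ∀ (x : Fin 2) → opposite (opposite x) ≡ x
  involutive zero       = refl
  involutive (suc zero) = refl

denotes-transpose : ∀ {k l} {e : Expr k l} {S : Span k l} → Denotes e S →
  Σ (Span l k) λ S' → Denotes (transposeE e) S' × SpanIso S' (transposeS S)
denotes-transpose dΔ = ∇S , d∇ , spanIso (CIso-refl (disc 1)) (λ _ _ → refl) (λ _ _ → refl)
denotes-transpose d⊥ = ⊤S , d⊤ , spanIso (CIso-refl (disc 1)) (λ _ ()) (λ _ _ → refl)
denotes-transpose d∇ = ΔS , dΔ , spanIso (CIso-refl (disc 1)) (λ _ _ → refl) (λ _ _ → refl)
denotes-transpose d⊤ = ⊥S , d⊥ , spanIso (CIso-refl (disc 1)) (λ _ _ → refl) (λ _ ())
denotes-transpose dΛ = VS , dV , spanIso (CIso-refl two) (λ _ _ → refl) (λ _ _ → refl)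
denotes-transpose d↓ = ↑S , d↑ , spanIso (CIso-refl empty) (λ ()) (λ ())
denotes-transpose dV = ΛS , dΛ , spanIso (CIso-refl two) (λ _ _ → refl) (λ _ _ → refl)
denotes-transpose d↑ = ↓S , d↓ , spanIso (CIso-refl empty) (λ ()) (λ ())
denotes-transpose dI = IS , dI , spanIso (CIso-refl (disc 1)) (λ _ _ → refl) (λ _ _ → refl)
denotes-transpose dX = XS , dX ,
  spanIso exchange-iso (λ { zero j → refl ; (suc zero) j → refl }) (λ _ _ → refl)
denotes-transpose (d⊗ D₁ D₂) =
  let (S₁' , D₁' , iso₁) = denotes-transpose D₁
      (S₂' , D₂' , iso₂) = denotes-transpose D₂
  in S₁' ⊗S S₂' , d⊗ D₁' D₂' , SpanIso-⊗ iso₁ iso₂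
denotes-transpose (d⨾ {l = l} {S₁ = S₁} {S₂} D₁ D₂ P p₁ p₂ wP a₁ a₂ pb) =
  let (_ , D₁' , iso₁) = denotes-transpose D₁
      (_ , D₂' , iso₂) = denotes-transpose D₂
  in denotes-⨾ D₂' iso₂ D₁' iso₁ P p₂ p₁ wP a₂ a₁
       (pullback-sym {carrier S₁} {carrier S₂} {disc l} {right S₁} {left S₂} {P} {p₁} {p₂} pb)

∨-absorbˡ : ∀ {r s} → (Holds r → Holds s) → r ∨ s ≡ s
∨-absorbˡ {r} r⇒s = bool-ext (λ p → [ r⇒s , id ] (∨-elim {r} p)) (∨-introʳ {r})

∨-absorbʳ : ∀ {r s} → (Holds r → Holds s) → s ∨ r ≡ s
∨-absorbʳ {r} {s} r⇒s = bool-ext (λ p → [ id , r⇒s ] (∨-elim {s} p)) ∨-introˡ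

module Decomposition {k l : ℕ} (S : Span k l) (wS : WfSpan S) where
  C = carrier S
  n = size C
  a = left S
  b = right S
  N = n * n

  wC : IsCSet C
  wC = proj₁ wS

  member : Fin n → Fin n × Fin n → Bool
  member x (u , v) = (⌊ x ≟ u ⌋ ∨ ⌊ x ≟ v ⌋) ∧ con C u v

  member-con : ∀ x x' p → Holds (member x p) → Holds (member x' p) → Holds (con C x x')
  member-con x x' (u , v) p q
    with ∨-elim {⌊ x ≟ u ⌋} (∧-elimˡ p) | ∨-elim {⌊ x' ≟ u ⌋} (∧-elimˡ q)
  ... | inj₁ e | inj₁ e' = subst (Holds ∘ con C x) (trans (≟-sound e) (sym (≟-sound e'))) (proj₁ wC x)
  ... | inj₂ e | inj₂ e' = subst (Holds ∘ con C x) (trans (≟-sound e) (sym (≟-sound e'))) (proj₁ wC x)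
  ... | inj₁ e | inj₂ e' =
      subst₂ (λ t t' → Holds (con C t t')) (sym (≟-sound e)) (sym (≟-sound e')) (∧-elimʳ {⌊ x ≟ u ⌋ ∨ _} p)
  ... | inj₂ e | inj₁ e' = trans (proj₂ wC x x')
      (subst₂ (λ t t' → Holds (con C t t')) (sym (≟-sound e')) (sym (≟-sound e)) (∧-elimʳ {⌊ x ≟ u ⌋ ∨ _} p))

  member-fst : ∀ x x' → Holds (con C x x') → Holds (member x (x , x'))
  member-fst x x' c = ∧-intro (∨-introˡ (≟-refl x)) c

  member-snd : ∀ x x' → Holds (con C x x') → Holds (member x' (x , x'))
  member-snd x x' c = ∧-intro (∨-introʳ {⌊ x' ≟ x ⌋} (≟-refl x')) c

  b⁺ : Fin n → Sub (N + l)
  b⁺ x w = [ (λ s → member x (remQuot n s)) , b x ] (splitAt N w)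

  b⁺-pair : ∀ x u v → b⁺ x (combine u v ↑ˡ l) ≡ member x (u , v)
  b⁺-pair x u v = trans (cong [ (λ s → member x (remQuot n s)) , b x ] (splitAt-↑ˡ N (combine u v) l))
                        (cong (member x) (remQuot-combine u v))

  b⁺-inl : ∀ x s → b⁺ x (s ↑ˡ l) ≡ member x (remQuot n s)
  b⁺-inl x s = cong [ (λ s → member x (remQuot n s)) , b x ] (splitAt-↑ˡ N s l)

  b⁺-inr : ∀ x z → b⁺ x (N ↑ʳ z) ≡ b x z
  b⁺-inr x z = cong [ (λ s → member x (remQuot n s)) , b x ] (splitAt-↑ʳ N l z)

  b⁺-meets⇒con : ∀ x x' → Holds (meets b⁺ x x') → Holds (con C x x')
  b⁺-meets⇒con x x' p with meets-elim b⁺ p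
  ... | w , q , r with split N l w
  ...   | inl s = member-con x x' (remQuot n s) (trans (sym (b⁺-inl x s)) q) (trans (sym (b⁺-inl x' s)) r)
  ...   | inr z = proj₂ (proj₂ (proj₂ wS)) x x'
                    (z , z , trans (sym (b⁺-inr x z)) q , trans (sym (b⁺-inr x' z)) r , ≟-refl z)

  con⇒b⁺-meets : ∀ x x' → Holds (con C x x') → Holds (meets b⁺ x x')
  con⇒b⁺-meets x x' c = meets-intro b⁺ {z = combine x x' ↑ˡ l}
    (trans (b⁺-pair x x x') (member-fst x x' c)) (trans (b⁺-pair x' x x') (member-snd x x' c))

  conM-b⁺ : conM b⁺ ≈R con C
  conM-b⁺ x x' = bool-ext forth (λ c → ∨-introʳ {⌊ x ≟ x' ⌋} (con⇒b⁺-meets x x' c))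
    where
    forth : Holds (conM b⁺ x x') → Holds (con C x x')
    forth p with conM-elim b⁺ p
    ... | inj₁ e           = subst (Holds ∘ con C x) e (proj₁ wC x)
    ... | inj₂ (w , q , r) = b⁺-meets⇒con x x' (meets-intro b⁺ q r)

  b⁺-isArr : IsArr C (disc (N + l)) b⁺
  b⁺-isArr = (λ _ _ _ _ _ e → ≟-sound e) ,
    (λ x x' (w , w' , p , q , e) →
       b⁺-meets⇒con x x' (meets-intro b⁺ p (subst (Holds ∘ b⁺ x') (sym (≟-sound e)) q)))

  conM-a⇒con : ∀ x x' → Holds (conM a x x') → Holds (con C x x')
  conM-a⇒con x x' p with conM-elim a p
  ... | inj₁ e           = subst (Holds ∘ con C x) e (proj₁ wC x)
  ... | inj₂ (j , q , r) = proj₂ (proj₁ (proj₂ wS)) x x' (j , j , q , r , ≟-refl j)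

  cut : Fin (N + l) → Sub l
  cut = noneR0 {N} ⊕ ι l

  cut-image : ∀ y z → Holds (cut y z) → y ≡ N ↑ʳ z
  cut-image y z p with split N l y
  ... | inl s = refute (⊕-inl-inr (noneR0 {N}) (ι l) s z) p
  ... | inr i = cong (N ↑ʳ_) (≟-sound (trans (sym (⊕-inr-inr (noneR0 {N}) (ι l) i z)) p))

  cut-sparse : ∀ {y y'} → Holds (conM cut y y') → y ≡ y'
  cut-sparse {y} {y'} p with conM-elim cut p
  ... | inj₁ e           = e
  ... | inj₂ (z , q , r) = trans (cut-image y z q) (sym (cut-image y' z r))

  cut∘b⁺ : cut ∘R b⁺ ≈R b
  cut∘b⁺ x z = bool-ext forth back
    where
    forth : Holds ((cut ∘R b⁺) x z) → Holds (b x z)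
    forth p = let (y , q , r) = sharp-elim cut (b⁺ x) p in
      trans (sym (b⁺-inr x z)) (subst (Holds ∘ b⁺ x) (cut-image y z r) q)
    back : Holds (b x z) → Holds ((cut ∘R b⁺) x z)
    back p = sharp-intro cut (b⁺ x) (trans (b⁺-inr x z) p)
               (trans (⊕-inr-inr (noneR0 {N}) (ι l) z z) (≟-refl z))

  first-step : SpanIso (transposeS (Minimal a) ⨾M b⁺) (span C a b⁺)
  first-step = SpanIso-pointwise (carrier (transposeS (Minimal a) ⨾M b⁺))
    (λ x x' → trans (cong (conM a x x' ∨_) (trans (relate-ι (conM b⁺) x x') (conM-b⁺ x x')))
                    (∨-absorbˡ (conM-a⇒con x x')))
    (λ _ _ → refl) (sharp-singleton b⁺)

  second-step : SpanIso (span C a b⁺ ⨾M cut) S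
  second-step = SpanIso-pointwise (carrier (span C a b⁺ ⨾M cut))
    (λ x x' → ∨-absorbʳ (relate⇒con x x')) (λ _ _ → refl) cut∘b⁺
    where
    relate⇒con : ∀ x x' → Holds (relate b⁺ (conM cut) x x') → Holds (con C x x')
    relate⇒con x x' p =
      let (y , y' , q , r , c) = relate-elim b⁺ (conM cut) p
      in b⁺-meets⇒con x x' (meets-intro b⁺ q (subst (Holds ∘ b⁺ x') (sym (cut-sparse c)) r))

  decompose : Σ (Expr k l) λ e → Σ (Span k l) λ S' → Denotes e S' × SpanIso S' S
  decompose =
    let
        (_ , _ , Dₐ , isoₐ) = expressible-minimal n k a
        (_ , D₁ , iso₁) = denotes-transpose Dₐ
        (_ , _ , D₂ , iso₂) = expressible-minimal n (N + l) b⁺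
        (_ , _ , D₃ , iso₃) = expressible-⊗ (expressible-discard N) (expressible-ι l)
        (_ , D₁₂ , iso₁₂) =
          denotes-⨾M (transposeS (Minimal a)) b⁺ D₁ (SpanIso-trans iso₁ (SpanIso-transpose isoₐ))
            (Minimal-isCSet a) (Minimal-left a) D₂ iso₂ (λ x y y' p q _ → trans (sym (≟-sound p)) (≟-sound q))
        (S' , D' , iso') =
          denotes-⨾M (span C a b⁺) cut D₁₂ (SpanIso-trans iso₁₂ first-step)
            wC b⁺-isArr D₃ iso₃ (λ _ _ _ _ _ c → cut-sparse c)
    in _ , S' , D' , SpanIso-trans iso' second-step

theorem2 : {k l : ℕ} (S : Span k l) → WfSpan S →
    Σ (Expr k l) λ e → Σ (Span k l) λ S' → Denotes e S' × (S' ≅S S)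
theorem2 S wS =
  let (e , S' , D , iso) = Decomposition.decompose S wS in e , S' , D , SpanIso→≅ iso
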